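{- Suppose $n/2>s>t$ and $(t-1)\,f(n/2,s,t)\ge s$. Then there is no graph on $n$ vertices in which every induced subgraph on $s$ vertices contains both a clique of size $t$ and an independent set of size $t$.
   Context: For integers $N>s>t$, $f(N,s,t)$ denotes the largest integer $f$ such that every graph on $N$ vertices in which every induced subgraph on $s$ vertices has an independent set of size at least $t$ must contain an independent set of size at least $f$. (Here $n/2$ is rounded to an integer.) -}

module Defs where

open import Data.Nat using (ℕ; _≤_)
open import Data.Bool using (Bool; true; false)
open import Data.Fin using (Fin)
open import Data.Fin.Subset using (Subset; _∈_; _⊆_; ∣_∣; ⊤)
open import Data.Product using (Σ; _×_)
open import Relation.Binary.PropositionalEquality using (_≡_; _≢_)

record Graph (n : ℕ) : Set where
  field
    adj    : Fin n → Fin n → Bool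
    symm   : ∀ i j → adj i j ≡ adj j i
    irrefl : ∀ i → adj i i ≡ false

open Graph public

IsIndependent : ∀ {n} → Graph n → Subset n → Set
IsIndependent G I = ∀ i j → i ∈ I → j ∈ I → adj G i j ≡ false

IsClique : ∀ {n} → Graph n → Subset n → Set
IsClique G K = ∀ i j → i ∈ K → j ∈ K → i ≢ j → adj G i j ≡ true

HasIndepIn : ∀ {n} → Graph n → Subset n → ℕ → Set
HasIndepIn G S t = Σ (Subset _) λ I → I ⊆ S × t ≤ ∣ I ∣ × IsIndependent G I

HasCliqueIn : ∀ {n} → Graph n → Subset n → ℕ → Set
HasCliqueIn G S t = Σ (Subset _) λ K → K ⊆ S × t ≤ ∣ K ∣ × IsClique G K

EveryInducedHasIndep : ∀ {N} → Graph N → ℕ → ℕ → Set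
EveryInducedHasIndep G s t = ∀ S → ∣ S ∣ ≡ s → HasIndepIn G S t

Forces : ℕ → ℕ → ℕ → ℕ → Set
Forces N s t f = (G : Graph N) → EveryInducedHasIndep G s t → HasIndepIn G ⊤ f

IsF : ℕ → ℕ → ℕ → ℕ → Set
IsF N s t f = Forces N s t f × (∀ g → Forces N s t g → g ≤ f)

-- Colour greedily: as long as fewer than s vertices are coloured, the
-- uncoloured vertices number at least n − s > n/2, so by the definition of
-- f(n/2,s,t), applied to an induced subgraph on n/2 of them, they contain an
-- independent set of size f, which becomes a new colour class.  After t − 1
-- rounds at least min(s, (t−1)f) = s vertices carry t − 1 colours; any s of
-- them contain a t-clique, which needs t colours.
module Submission where

open import Defs
open import Data.Nat using (ℕ; zero; suc; _+_; _≤_; _<_; _*_; _∸_; _/_; z≤n; s≤s; _≤?_)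
open import Data.Nat.Properties
  using (+-suc; +-comm; +-mono-≤; +-monoʳ-≤; ≤-trans; <⇒≤; <-trans; <-irrefl; ≰⇒>; m<n⇒m<1+n; n<1+n; m+n≤o⇒m≤o∸n; *-comm; +-identityʳ)
open import Data.Nat.DivMod using (m/n*n≤m)
open import Data.Bool using (true; false)
open import Data.Fin using (Fin; zero; suc; toℕ; fromℕ<)
open import Data.Fin.Properties using (suc-injective; pigeonhole; toℕ-fromℕ<) renaming (<⇒≢ to <⇒≢ᶠ)
open import Data.Fin.Subset using (Subset; _∈_; _∉_; _⊆_; ∣_∣; ⊤; ⊥; ∁; _∪_; inside; outside)
open import Data.Fin.Subset.Properties
  using (_∈?_; drop-∷-⊆; ∣⊥∣≡0; ∣∁p∣≡n∸∣p∣; ∉⊥; x∈p∪q⁻)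
open import Data.Vec using ([]; _∷_; here; there)
open import Data.Product using (Σ; ∃; _×_; _,_; proj₁; proj₂)
open import Data.Sum using (_⊎_; inj₁; inj₂; [_,_]′)
open import Data.Empty using (⊥-elim)
open import Function using (_∘_; id)
open import Relation.Nullary using (¬_; Dec; yes; no; contradiction)
open import Relation.Binary.PropositionalEquality
  using (_≡_; _≢_; refl; sym; trans; cong; subst)

private
  variable
    n m k s t f : ℕ

∣p∪q∣≡∣p∣+∣q∣ : (p q : Subset n) → q ⊆ ∁ p → ∣ p ∪ q ∣ ≡ ∣ p ∣ + ∣ q ∣
∣p∪q∣≡∣p∣+∣q∣ [] [] _ = refl
∣p∪q∣≡∣p∣+∣q∣ (inside ∷ p) (inside ∷ q) q⊆∁p with q⊆∁p here
... | ()
∣p∪q∣≡∣p∣+∣q∣ (inside ∷ p) (outside ∷ q) q⊆∁p =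
  cong suc (∣p∪q∣≡∣p∣+∣q∣ p q (drop-∷-⊆ q⊆∁p))
∣p∪q∣≡∣p∣+∣q∣ (outside ∷ p) (inside ∷ q) q⊆∁p =
  trans (cong suc (∣p∪q∣≡∣p∣+∣q∣ p q (drop-∷-⊆ q⊆∁p))) (sym (+-suc ∣ p ∣ ∣ q ∣))
∣p∪q∣≡∣p∣+∣q∣ (outside ∷ p) (outside ∷ q) q⊆∁p = ∣p∪q∣≡∣p∣+∣q∣ p q (drop-∷-⊆ q⊆∁p)

subsetOfSize : ∀ k (p : Subset n) → k ≤ ∣ p ∣ → ∃ λ q → q ⊆ p × ∣ q ∣ ≡ k
subsetOfSize {n} zero p _ = ⊥ , ⊥-elim ∘ ∉⊥ , ∣⊥∣≡0 n
subsetOfSize (suc k) (outside ∷ p) k<∣p∣ with subsetOfSize (suc k) p k<∣p∣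
... | q , q⊆p , ∣q∣≡k = outside ∷ q , (λ { (there x∈q) → there (q⊆p x∈q) }) , ∣q∣≡k
subsetOfSize (suc k) (inside ∷ p) (s≤s k≤∣p∣) with subsetOfSize k p k≤∣p∣
... | q , q⊆p , ∣q∣≡k =
  inside ∷ q , (λ { here → here ; (there x∈q) → there (q⊆p x∈q) }) , cong suc ∣q∣≡k

element : (R : Subset n) → Fin ∣ R ∣ → Fin n
element (inside ∷ R) zero = zero
element (inside ∷ R) (suc i) = suc (element R i)
element (outside ∷ R) i = suc (element R i)

element-∈ : (R : Subset n) (i : Fin ∣ R ∣) → element R i ∈ R
element-∈ (inside ∷ R) zero = here
element-∈ (inside ∷ R) (suc i) = there (element-∈ R i)
element-∈ (outside ∷ R) i = there (element-∈ R i)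

element-injective : (R : Subset n) {i j : Fin ∣ R ∣} → element R i ≡ element R j → i ≡ j
element-injective (inside ∷ R) {zero} {zero} _ = refl
element-injective (inside ∷ R) {suc i} {suc j} eq = cong suc (element-injective R (suc-injective eq))
element-injective (outside ∷ R) eq = element-injective R (suc-injective eq)

-- push R S is the image of S under element R, and pull R I the preimage of I.
push : (R : Subset n) → Subset ∣ R ∣ → Subset n
push [] [] = []
push (inside ∷ R) (x ∷ S) = x ∷ push R S
push (outside ∷ R) S = outside ∷ push R S

pull : (R : Subset n) → Subset n → Subset ∣ R ∣
pull [] [] = []
pull (inside ∷ R) (x ∷ I) = x ∷ pull R I
pull (outside ∷ R) (_ ∷ I) = pull R I

∣push∣ : (R : Subset n) (S : Subset ∣ R ∣) → ∣ push R S ∣ ≡ ∣ S ∣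
∣push∣ [] [] = refl
∣push∣ (inside ∷ R) (inside ∷ S) = cong suc (∣push∣ R S)
∣push∣ (inside ∷ R) (outside ∷ S) = ∣push∣ R S
∣push∣ (outside ∷ R) S = ∣push∣ R S

∣pull∣ : (R I : Subset n) → I ⊆ R → ∣ pull R I ∣ ≡ ∣ I ∣
∣pull∣ [] [] _ = refl
∣pull∣ (inside ∷ R) (inside ∷ I) I⊆R = cong suc (∣pull∣ R I (drop-∷-⊆ I⊆R))
∣pull∣ (inside ∷ R) (outside ∷ I) I⊆R = ∣pull∣ R I (drop-∷-⊆ I⊆R)
∣pull∣ (outside ∷ R) (outside ∷ I) I⊆R = ∣pull∣ R I (drop-∷-⊆ I⊆R)
∣pull∣ (outside ∷ R) (inside ∷ I) I⊆R with I⊆R here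
... | ()

push-⊆ : (R : Subset n) (S : Subset ∣ R ∣) → push R S ⊆ R
push-⊆ (inside ∷ R) (_ ∷ S) here = here
push-⊆ (inside ∷ R) (_ ∷ S) (there x∈) = there (push-⊆ R S x∈)
push-⊆ (outside ∷ R) S (there x∈) = there (push-⊆ R S x∈)

push-∈⁻ : (R : Subset n) {S : Subset ∣ R ∣} {x : Fin n} →
          x ∈ push R S → ∃ λ i → i ∈ S × element R i ≡ x
push-∈⁻ (inside ∷ R) {_ ∷ S} {zero} here = zero , here , refl
push-∈⁻ (inside ∷ R) {_ ∷ S} {suc x} (there x∈) with push-∈⁻ R x∈
... | i , i∈S , refl = suc i , there i∈S , refl
push-∈⁻ (outside ∷ R) {S} {suc x} (there x∈) with push-∈⁻ R x∈
... | i , i∈S , refl = i , i∈S , refl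

element-∈-push⁻ : (R : Subset n) {S : Subset ∣ R ∣} {i : Fin ∣ R ∣} →
                  element R i ∈ push R S → i ∈ S
element-∈-push⁻ (inside ∷ R) {_ ∷ S} {zero} here = here
element-∈-push⁻ (inside ∷ R) {_ ∷ S} {suc i} (there i∈) = there (element-∈-push⁻ R i∈)
element-∈-push⁻ (outside ∷ R) (there i∈) = element-∈-push⁻ R i∈

element-∈-pull : (R : Subset n) {I : Subset n} {i : Fin ∣ R ∣} →
                 i ∈ pull R I → element R i ∈ I
element-∈-pull (inside ∷ R) {_ ∷ I} {zero} here = here
element-∈-pull (inside ∷ R) {_ ∷ I} {suc i} (there i∈) = there (element-∈-pull R i∈)
element-∈-pull (outside ∷ R) {_ ∷ I} i∈ = there (element-∈-pull R i∈)

induced : Graph n → (R : Subset n) → Graph ∣ R ∣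
induced G R = record
  { adj    = λ i j → adj G (element R i) (element R j)
  ; symm   = λ i j → symm G (element R i) (element R j)
  ; irrefl = λ i → irrefl G (element R i)
  }

module _ (G : Graph n) (R : Subset n) where

  pull-independent : ∀ {I} → IsIndependent G I → IsIndependent (induced G R) (pull R I)
  pull-independent indI i j i∈ j∈ = indI _ _ (element-∈-pull R i∈) (element-∈-pull R j∈)

  push-independent : ∀ {J} → IsIndependent (induced G R) J → IsIndependent G (push R J)
  push-independent {J} indJ x y x∈ y∈ with push-∈⁻ R x∈ | push-∈⁻ R y∈
  ... | i , i∈J , refl | j , j∈J , refl = indJ i j i∈J j∈J

  induced-everyInducedHasIndep : EveryInducedHasIndep G s t →
                                 EveryInducedHasIndep (induced G R) s t
  induced-everyInducedHasIndep {s} {t} hyp S ∣S∣≡s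
    with hyp (push R S) (trans (∣push∣ R S) ∣S∣≡s)
  ... | I , I⊆pushS , t≤∣I∣ , indI =
    pull R I , pull⊆S , t≤∣pullI∣ , pull-independent indI
    where
    pull⊆S : pull R I ⊆ S
    pull⊆S i∈ = element-∈-push⁻ R (I⊆pushS (element-∈-pull R i∈))
    t≤∣pullI∣ : t ≤ ∣ pull R I ∣
    t≤∣pullI∣ = subst (t ≤_) (sym (∣pull∣ R I (push-⊆ R S ∘ I⊆pushS))) t≤∣I∣

  hasIndepIn-push : ∀ {f} → HasIndepIn (induced G R) ⊤ f → HasIndepIn G R f
  hasIndepIn-push {f} (J , _ , f≤∣J∣ , indJ) =
    push R J , push-⊆ R J , subst (f ≤_) (sym (∣push∣ R J)) f≤∣J∣ , push-independent indJ

forces-inSubset : Forces m s t f → (G : Graph n) → EveryInducedHasIndep G s t →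
                  (R : Subset n) → m ≤ ∣ R ∣ → HasIndepIn G R f
forces-inSubset {m} {s} {t} {f} forces G hyp R m≤∣R∣
  with subsetOfSize m R m≤∣R∣
... | R′ , R′⊆R , ∣R′∣≡m
  with subst (λ k → Forces k s t f) (sym ∣R′∣≡m) forces (induced G R′)
             (induced-everyInducedHasIndep G R′ hyp)
... | indep with hasIndepIn-push G R′ indep
... | J , J⊆R′ , f≤∣J∣ , indJ = J , R′⊆R ∘ J⊆R′ , f≤∣J∣ , indJ

-- Colours of vertices outside U are junk.
record Colouring (G : Graph n) (U : Subset n) (k : ℕ) : Set where
  field
    colour  : Fin n → ℕ
    bounded : ∀ {i} → i ∈ U → colour i < k
    proper  : ∀ {i j} → i ∈ U → j ∈ U → colour i ≡ colour j → adj G i j ≡ false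

open Colouring

emptyColouring : (G : Graph n) → Colouring G ⊥ 0
emptyColouring G = record
  { colour  = λ _ → 0
  ; bounded = ⊥-elim ∘ ∉⊥
  ; proper  = λ i∈⊥ _ _ → ⊥-elim (∉⊥ i∈⊥)
  }

weakenColouring : ∀ {G : Graph n} {U} → Colouring G U k → Colouring G U (suc k)
weakenColouring χ = record
  { colour = colour χ ; bounded = m<n⇒m<1+n ∘ bounded χ ; proper = proper χ }

extendColouring : ∀ {G : Graph n} {U J} → Colouring G U k → J ⊆ ∁ U →
                  IsIndependent G J → Colouring G (U ∪ J) (suc k)
extendColouring {k = k} {G = G} {U} {J} χ J⊆∁U indJ = record
  { colour = colour′ ; bounded = bounded′ ; proper = proper′ }
  where
  paint : ∀ i → Dec (i ∈ J) → ℕ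
  paint i (yes _) = k
  paint i (no _)  = colour χ i

  colour′ : Fin _ → ℕ
  colour′ i = paint i (i ∈? J)

  ∈U : ∀ {i} → i ∈ U ∪ J → i ∉ J → i ∈ U
  ∈U i∈U∪J i∉J with x∈p∪q⁻ U J i∈U∪J
  ... | inj₁ i∈U = i∈U
  ... | inj₂ i∈J = contradiction i∈J i∉J

  bounded′ : ∀ {i} → i ∈ U ∪ J → colour′ i < suc k
  bounded′ {i} i∈ with i ∈? J
  ... | yes _   = n<1+n k
  ... | no i∉J = m<n⇒m<1+n (bounded χ (∈U i∈ i∉J))

  proper′ : ∀ {i j} → i ∈ U ∪ J → j ∈ U ∪ J → colour′ i ≡ colour′ j → adj G i j ≡ false
  proper′ {i} {j} i∈ j∈ with i ∈? J | j ∈? J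
  ... | yes i∈J | yes j∈J = λ _ → indJ i j i∈J j∈J
  ... | yes _   | no j∉J = λ k≡cj → ⊥-elim (<-irrefl (sym k≡cj) (bounded χ (∈U j∈ j∉J)))
  ... | no i∉J | yes _   = λ ci≡k → ⊥-elim (<-irrefl ci≡k (bounded χ (∈U i∈ i∉J)))
  ... | no i∉J | no j∉J = proper χ (∈U i∈ i∉J) (∈U j∈ j∉J)

-- Pigeonhole: two clique vertices sharing a colour would be both adjacent
-- and non-adjacent.
clique-size≤colours : ∀ {G : Graph n} {U K} → Colouring G U k →
                      IsClique G K → K ⊆ U → ∣ K ∣ ≤ k
clique-size≤colours {k = k} {G = G} {U} {K} χ clique K⊆U with ∣ K ∣ ≤? k
... | yes ∣K∣≤k = ∣K∣≤k
... | no ∣K∣≰k with pigeonhole (≰⇒> ∣K∣≰k) colourᶠ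
  where
  colourᶠ : Fin ∣ K ∣ → Fin k
  colourᶠ i = fromℕ< (bounded χ (K⊆U (element-∈ K i)))
... | i , j , i<j , sameColour = ⊥-elim (true≢false (trans (sym adjacent) nonAdjacent))
  where
  x = element K i
  y = element K j
  true≢false : true ≢ false
  true≢false ()
  adjacent : adj G x y ≡ true
  adjacent = clique x y (element-∈ K i) (element-∈ K j) (<⇒≢ᶠ i<j ∘ element-injective K)
  nonAdjacent : adj G x y ≡ false
  nonAdjacent = proper χ (K⊆U (element-∈ K i)) (K⊆U (element-∈ K j))
    (trans (sym (toℕ-fromℕ< _)) (trans (cong toℕ sameColour) (toℕ-fromℕ< _)))

greedyColouring : (G : Graph n) →
                  (∀ U → ∣ U ∣ < s → HasIndepIn G (∁ U) f) →
                  ∀ k → ∃ λ U → Colouring G U k × (s ≤ ∣ U ∣ ⊎ k * f ≤ ∣ U ∣)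
greedyColouring G _ zero = ⊥ , emptyColouring G , inj₂ z≤n
greedyColouring {s = s} {f = f} G extract (suc k) with greedyColouring G extract k
... | U , χ , size with s ≤? ∣ U ∣
...   | yes s≤∣U∣ = U , weakenColouring χ , inj₁ s≤∣U∣
...   | no s≰∣U∣ with extract U (≰⇒> s≰∣U∣)
...     | J , J⊆∁U , f≤∣J∣ , indJ = U ∪ J , extendColouring χ J⊆∁U indJ , inj₂ grown
  where
  kf≤∣U∣ : k * f ≤ ∣ U ∣
  kf≤∣U∣ = [ (λ s≤∣U∣ → contradiction s≤∣U∣ s≰∣U∣) , id ]′ size
  grown : suc k * f ≤ ∣ U ∪ J ∣
  grown = subst (suc k * f ≤_) (sym (trans (∣p∪q∣≡∣p∣+∣q∣ U J J⊆∁U) (+-comm ∣ U ∣ ∣ J ∣)))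
                (+-mono-≤ f≤∣J∣ kf≤∣U∣)

half≤n∸u : ∀ n {u} → u < n / 2 → n / 2 ≤ n ∸ u
half≤n∸u n {u} u<n/2 = m+n≤o⇒m≤o∸n (n / 2) (≤-trans (+-monoʳ-≤ (n / 2) (<⇒≤ u<n/2)) twoHalves≤n)
  where
  twoHalves≤n : n / 2 + n / 2 ≤ n
  twoHalves≤n = subst (_≤ n) (trans (*-comm (n / 2) 2) (cong (n / 2 +_) (+-identityʳ (n / 2))))
                      (m/n*n≤m n 2)

mainTheorem6 : (n s t : ℕ) → t < s → s < n / 2 →
    Σ ℕ (λ f → IsF (n / 2) s t f × s ≤ (t ∸ 1) * f) →
    ¬ Σ (Graph n) (λ G → ∀ S → ∣ S ∣ ≡ s → HasCliqueIn G S t × HasIndepIn G S t)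
mainTheorem6 n s zero 0<s _ (_ , _ , s≤0) _ = <-irrefl refl (≤-trans 0<s s≤0)
mainTheorem6 n s (suc t) t<s s<n/2 (f , (forces , _) , s≤tf) (G , cliqueAndIndep) =
  let U , χ , size          = greedyColouring G extract t
      S , S⊆U , ∣S∣≡s       = subsetOfSize s U (s≤size size)
      K , K⊆S , t<∣K∣ , clique = proj₁ (cliqueAndIndep S ∣S∣≡s)
  in  <-irrefl refl (≤-trans t<∣K∣ (clique-size≤colours χ clique (S⊆U ∘ K⊆S)))
  where
  extract : ∀ U → ∣ U ∣ < s → HasIndepIn G (∁ U) f
  extract U ∣U∣<s =
    forces-inSubset forces G (λ S ∣S∣≡s → proj₂ (cliqueAndIndep S ∣S∣≡s)) (∁ U)
      (subst (n / 2 ≤_) (sym (∣∁p∣≡n∸∣p∣ U)) (half≤n∸u n (<-trans ∣U∣<s s<n/2)))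
  s≤size : ∀ {u} → s ≤ u ⊎ t * f ≤ u → s ≤ u
  s≤size = [ id , ≤-trans s≤tf ]′
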